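{- The forgetful 2-functor $\mathbf{C}^2 : \mathbf{Scwf}^2_{\mathrm{dem}} \to \mathbf{CCp}^2$ (sending a democratic scwf to its base category, a democratic pseudo scwf-morphism to its base functor, and a 2-cell to itself) and the 2-functor $\mathbf{L}^2 : \mathbf{CCp}^2 \to \mathbf{Scwf}^2_{\mathrm{dem}}$ described below form a biequivalence of 2-categories between $\mathbf{CCp}^2$ and $\mathbf{Scwf}^2_{\mathrm{dem}}$.
   Context: A category is cartesian (as a property) if there merely exists a terminal object and, for any two objects, a product of them. A functor between such categories is cartesian if it sends terminal objects to terminal objects and product diagrams to product diagrams. $\mathbf{CCp}^2$ is the 2-category of small cartesian categories, cartesian functors, and natural transformations. A simply typed cwf (scwf) consists of a category $\mathcal{C}$ with a chosen terminal object $1$; a set $\mathrm{Ty}$; for each $A \in \mathrm{Ty}$ a presheaf $\mathrm{Tm}(-,A)$ on $\mathcal{C}$ (action written $a[\gamma]$); and for each $\Gamma$, $A$ a chosen $\Gamma\cdot A$, $\mathrm{p}_{\Gamma,A} : \Gamma\cdot A \to \Gamma$, $\mathrm{q}_{\Gamma,A} \in \mathrm{Tm}(\Gamma\cdot A,A)$ (a "context comprehension") such that for all $\gamma : \Delta\to\Gamma$, $a \in \mathrm{Tm}(\Delta,A)$ there is a unique $\langle\gamma,a\rangle : \Delta \to \Gamma\cdot A$ with $\mathrm{p}\circ\langle\gamma,a\rangle=\gamma$ and $\mathrm{q}[\langle\gamma,a\rangle]=a$. For each $\Gamma$, $\mathrm{Ty}(\Gamma)$ denotes the category with objects $\mathrm{Ty}$,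 morphisms $A\to B$ the terms in $\mathrm{Tm}(\Gamma\cdot A,B)$, composition $c\circ b = c[\langle \mathrm{p}_{\Gamma,A},b\rangle]$ and identities $\mathrm{q}_{\Gamma,A}$. An scwf is democratic if it comes with, for each context $\Gamma$, a type $\overline{\Gamma}$ and an isomorphism $\gamma_\Gamma : \Gamma \cong 1\cdot\overline{\Gamma}$. A pseudo scwf-morphism $\mathcal{C}\to\mathcal{D}$ consists of a functor $F$, a function $F^{\mathrm{Ty}}$ on types and natural transformations $F^{\mathrm{Tm}}_A : \mathrm{Tm}(-,A) \Rightarrow \mathrm{Tm}(F-,F^{\mathrm{Ty}}A)$ such that $F1$ is terminal and each $(F(\Gamma\cdot A), F(\mathrm{p}_{\Gamma,A}), F^{\mathrm{Tm}}(\mathrm{q}_{\Gamma,A}))$ is a context comprehension of $F\Gamma$ and $F^{\mathrm{Ty}}A$ in $\mathcal{D}$. It is democratic (between democratic scwfs) if it has, for each $\Gamma$, an isomorphism $\mathrm{d}_\Gamma : F^{\mathrm{Ty}}(\overline{\Gamma}) \cong \overline{F\Gamma}$ in $\mathrm{Ty}^{\mathcal{D}}(1)$, subject to the coherence condition that $F(\gamma_\Gamma)$ agrees with $\gamma_{F\Gamma}$ modulo the canonical transports, i.e. $\langle\mathrm{p},\mathrm{d}_\Gamma\rangle\circ\langle\langle\rangle, F^{\mathrm{Tm}}(\mathrm{q}_{1,\overline\Gamma})\rangle\circ F(\gamma_\Gamma) = \gamma_{F\Gamma}$. $\mathbf{Scwf}^2_{\mathrm{dem}}$ is the 2-category of small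 democratic scwfs, democratic pseudo scwf-morphisms, and natural transformations between the underlying functors as 2-cells. $\mathbf{L}^2$ is defined by choosing in each cartesian category $\mathcal{C}$ a terminal object $1$ and a product $(A\times B,\mathrm{fst},\mathrm{snd})$ for all $A,B$, and sending $\mathcal{C}$ to the scwf with base category $\mathcal{C}$, types $\mathcal{C}_0$, terms $\mathrm{Tm}(\Gamma,A) = \mathcal{C}(\Gamma,A)$ (substitution by composition), context comprehension $\Gamma\cdot A = \Gamma\times A$ with $\mathrm{p} = \mathrm{fst}$, $\mathrm{q} = \mathrm{snd}$, and democracy $\overline{\Gamma} = \Gamma$ with the canonical isomorphism $\Gamma\cong 1\times\Gamma$; a cartesian functor is extended to types and terms by its own action, and 2-cells are unchanged. -}

module Defs where

open import Relation.Binary.PropositionalEquality using (_≡_; refl; sym; trans; cong)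
open import Data.Product using (Σ; _×_; _,_; proj₁; proj₂; Σ-syntax)

record Category : Set₁ where
  infixr 9 _∘_
  field
    Obj : Set
    Hom : Obj → Obj → Set
    id  : ∀ {A} → Hom A A
    _∘_ : ∀ {A B C} → Hom B C → Hom A B → Hom A C
    identityˡ : ∀ {A B} (f : Hom A B) → id ∘ f ≡ f
    identityʳ : ∀ {A B} (f : Hom A B) → f ∘ id ≡ f
    assoc : ∀ {A B C D} (h : Hom C D) (g : Hom B C) (f : Hom A B) →
            (h ∘ g) ∘ f ≡ h ∘ (g ∘ f)

record Functor (C D : Category) : Set where
  private
    module C = Category C
    module D = Category D
  field
    F₀ : C.Obj → D.Obj
    F₁ : ∀ {A B} → C.Hom A B → D.Hom (F₀ A) (F₀ B)
    F-id : ∀ {A} → F₁ (C.id {A}) ≡ D.id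
    F-∘ : ∀ {A B E} (g : C.Hom B E) (f : C.Hom A B) →
          F₁ (g C.∘ f) ≡ F₁ g D.∘ F₁ f

open Functor public

IdF : (C : Category) → Functor C C
IdF C = record
  { F₀ = λ x → x ; F₁ = λ f → f ; F-id = refl ; F-∘ = λ g f → refl }

infixr 9 _∘F_
_∘F_ : {C D E : Category} → Functor D E → Functor C D → Functor C E
_∘F_ {C} {D} {E} G F = record
  { F₀ = λ x → F₀ G (F₀ F x)
  ; F₁ = λ f → F₁ G (F₁ F f)
  ; F-id = trans (cong (F₁ G) (F-id F)) (F-id G)
  ; F-∘ = λ g f → trans (cong (F₁ G) (F-∘ F g f)) (F-∘ G (F₁ F g) (F₁ F f))
  }

-- natural transformations (these are the 2-cells of both 2-categories)
record NatTrans {C D : Category} (F G : Functor C D) : Set where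
  open Category D
  field
    η : ∀ x → Hom (F₀ F x) (F₀ G x)
    natural : ∀ {x y} (f : Category.Hom C x y) →
              η y ∘ F₁ F f ≡ F₁ G f ∘ η x

record NatIso {C D : Category} (F G : Functor C D) : Set where
  open Category D
  field
    fwd : NatTrans F G
    bwd : NatTrans G F
    isoˡ : ∀ x → NatTrans.η bwd x ∘ NatTrans.η fwd x ≡ id
    isoʳ : ∀ x → NatTrans.η fwd x ∘ NatTrans.η bwd x ≡ id

record Iso (C : Category) (A B : Category.Obj C) : Set where
  open Category C
  field
    to   : Hom A B
    from : Hom B A
    isoˡ : from ∘ to ≡ id
    isoʳ : to ∘ from ≡ id

module _ (C : Category) where
  open Category C

  IsTerminal : Obj → Set
  IsTerminal T = ∀ X → Σ[ f ∈ Hom X T ] (∀ g → g ≡ f)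

  IsProduct : ∀ {A B P} → Hom P A → Hom P B → Set
  IsProduct {A} {B} {P} π₁ π₂ =
    ∀ {X} (f : Hom X A) (g : Hom X B) →
    Σ[ h ∈ Hom X P ] ((π₁ ∘ h ≡ f) × (π₂ ∘ h ≡ g) ×
                      (∀ h' → π₁ ∘ h' ≡ f → π₂ ∘ h' ≡ g → h' ≡ h))

  record CartStr : Set where
    field
      𝟙 : Obj
      𝟙-term : IsTerminal 𝟙
      _⊗_ : Obj → Obj → Obj
      fst : ∀ {A B} → Hom (A ⊗ B) A
      snd : ∀ {A B} → Hom (A ⊗ B) B
      prod : ∀ {A B} → IsProduct (fst {A} {B}) (snd {A} {B})

IsCartFunctor : {C D : Category} → Functor C D → Set
IsCartFunctor {C} {D} F =
  (∀ T → IsTerminal C T → IsTerminal D (F₀ F T)) ×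
  (∀ {A B P} (π₁ : Category.Hom C P A) (π₂ : Category.Hom C P B) →
     IsProduct C π₁ π₂ → IsProduct D (F₁ F π₁) (F₁ F π₂))

-- objects of CCp²  (cartesian structure is carried as data)
record CartCat : Set₁ where
  field
    cat : Category
    str : CartStr cat

record CartFun (C D : CartCat) : Set where
  field
    fun  : Functor (CartCat.cat C) (CartCat.cat D)
    cart : IsCartFunctor fun

record PreScwf : Set₁ where
  field
    cat : Category
  open Category cat
  field
    Ty : Set
    Tm : Obj → Ty → Set
    _[_] : ∀ {Γ Δ A} → Tm Γ A → Hom Δ Γ → Tm Δ A
    [id] : ∀ {Γ A} (a : Tm Γ A) → a [ id ] ≡ a
    [∘] : ∀ {Γ Δ Θ A} (a : Tm Γ A) (γ : Hom Δ Γ) (δ : Hom Θ Δ) →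
          a [ γ ∘ δ ] ≡ (a [ γ ]) [ δ ]

IsCompr : (S : PreScwf) (Γ : Category.Obj (PreScwf.cat S)) (A : PreScwf.Ty S)
          (E : Category.Obj (PreScwf.cat S)) →
          Category.Hom (PreScwf.cat S) E Γ → PreScwf.Tm S E A → Set
IsCompr S Γ A E pE qE =
  ∀ {Δ} (γ : Hom Δ Γ) (a : Tm Δ A) →
  Σ[ h ∈ Hom Δ E ] ((pE ∘ h ≡ γ) × (qE [ h ] ≡ a) ×
                    (∀ h' → pE ∘ h' ≡ γ → qE [ h' ] ≡ a → h' ≡ h))
  where open PreScwf S
        open Category cat

record Scwf : Set₁ where
  field
    pre : PreScwf
  open PreScwf pre public
  open Category cat
  field
    𝟏 : Obj
    𝟏-term : IsTerminal cat 𝟏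
    _·_ : Obj → Ty → Obj
    p : ∀ {Γ A} → Hom (Γ · A) Γ
    q : ∀ {Γ A} → Tm (Γ · A) A
    compr : ∀ {Γ A} → IsCompr pre Γ A (Γ · A) p q

  ⟨_,_⟩ : ∀ {Δ Γ A} → Hom Δ Γ → Tm Δ A → Hom Δ (Γ · A)
  ⟨ γ , a ⟩ = proj₁ (compr γ a)

  ! : ∀ Δ → Hom Δ 𝟏
  ! Δ = proj₁ (𝟏-term Δ)

-- isomorphisms in the category Ty(Γ)
--   (morphisms A → B are terms Tm (Γ · A) B, composition c ∘ b = c [ ⟨ p , b ⟩ ],
--    identities q)
record TyIso (S : Scwf) (Γ : Category.Obj (Scwf.cat S)) (A B : Scwf.Ty S) : Set where
  open Scwf S
  field
    to   : Tm (Γ · A) B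
    from : Tm (Γ · B) A
    isoˡ : from [ ⟨ p , to ⟩ ] ≡ q
    isoʳ : to [ ⟨ p , from ⟩ ] ≡ q

record DemScwf : Set₁ where
  field
    scwf : Scwf
  open Scwf scwf public
  field
    ov : Category.Obj cat → Ty
    γd : ∀ Γ → Iso cat Γ (𝟏 · ov Γ)

record DemMor (X Y : DemScwf) : Set where
  private
    module X = DemScwf X
    module Y = DemScwf Y
    module CY = Category Y.cat
  field
    F    : Functor X.cat Y.cat
    FTy  : X.Ty → Y.Ty
    FTm  : ∀ {Γ A} → X.Tm Γ A → Y.Tm (F₀ F Γ) (FTy A)
    FTm-nat : ∀ {Γ Δ A} (a : X.Tm Γ A) (γ : Category.Hom X.cat Δ Γ) →
              FTm (a X.[ γ ]) ≡ (FTm a) Y.[ F₁ F γ ]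
    F𝟏   : IsTerminal Y.cat (F₀ F X.𝟏)
    Fcompr : ∀ Γ A → IsCompr Y.pre (F₀ F Γ) (FTy A) (F₀ F (Γ X.· A))
                                (F₁ F (X.p {Γ} {A})) (FTm (X.q {Γ} {A}))
    d    : ∀ Γ → TyIso Y.scwf Y.𝟏 (FTy (X.ov Γ)) (Y.ov (F₀ F Γ))
    coh  : ∀ Γ →
      Y.⟨ Y.p , TyIso.to (d Γ) ⟩ CY.∘
        (Y.⟨ Y.! (F₀ F (X.𝟏 X.· X.ov Γ)) , FTm X.q ⟩ CY.∘ F₁ F (Iso.to (X.γd Γ)))
      ≡ Iso.to (Y.γd (F₀ F Γ))

und : {X Y : DemScwf} → DemMor X Y → Functor (DemScwf.cat X) (DemScwf.cat Y)
und = DemMor.F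

-- The 2-functor L² : CCp² → Scwf²_dem

module _ (C : CartCat) where
  private
    open CartCat C
    open Category cat
    open CartStr str

    pair : ∀ {X A B} → Hom X A → Hom X B → Hom X (A ⊗ B)
    pair f g = proj₁ (prod f g)

    !' : ∀ X → Hom X 𝟙
    !' X = proj₁ (𝟙-term X)

  Lpre : PreScwf
  Lpre = record
    { cat = cat ; Ty = Obj ; Tm = Hom ; _[_] = λ a γ → a ∘ γ
    ; [id] = identityʳ ; [∘] = λ a γ δ → sym (assoc a γ δ) }

  Lscwf : Scwf
  Lscwf = record
    { pre = Lpre ; 𝟏 = 𝟙 ; 𝟏-term = 𝟙-term ; _·_ = _⊗_
    ; p = fst ; q = snd ; compr = prod }

  canon : ∀ Γ → Iso cat Γ (𝟙 ⊗ Γ)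
  canon Γ = record
    { to = pair (!' Γ) id
    ; from = snd
    ; isoˡ = proj₁ (proj₂ (proj₂ (prod (!' Γ) id)))
    ; isoʳ = trans (u (pair (!' Γ) id ∘ snd) e1 e2)
                   (sym (u id (identityʳ fst) (identityʳ snd)))
    }
    where
      u = proj₂ (proj₂ (proj₂ (prod {𝟙} {Γ} {𝟙 ⊗ Γ} fst snd)))
      e1 : fst ∘ (pair (!' Γ) id ∘ snd) ≡ fst
      e1 = trans (proj₂ (𝟙-term (𝟙 ⊗ Γ)) _) (sym (proj₂ (𝟙-term (𝟙 ⊗ Γ)) fst))
      e2 : snd ∘ (pair (!' Γ) id ∘ snd) ≡ snd
      e2 = trans (sym (assoc snd (pair (!' Γ) id) snd))
             (trans (cong (_∘ snd) (proj₁ (proj₂ (proj₂ (prod (!' Γ) id)))))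
                    (identityˡ snd))

  L₀ : DemScwf
  L₀ = record { scwf = Lscwf ; ov = λ Γ → Γ ; γd = canon }

L₁ : {C D : CartCat} → CartFun C D → DemMor (L₀ C) (L₀ D)
L₁ {C} {D} Fc = record
  { F = F
  ; FTy = F₀ F
  ; FTm = F₁ F
  ; FTm-nat = λ a γ → F-∘ F a γ
  ; F𝟏 = proj₁ (CartFun.cart Fc) C.𝟙 C.𝟙-term
  ; Fcompr = λ Γ A → proj₂ (CartFun.cart Fc) C.fst C.snd C.prod
  ; d = λ Γ → record
      { to = D.snd ; from = D.snd
      ; isoˡ = proj₁ (proj₂ (proj₂ (D.prod D.fst D.snd)))
      ; isoʳ = proj₁ (proj₂ (proj₂ (D.prod D.fst D.snd))) }
  ; coh = coh
  }
  where
    F = CartFun.fun Fc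
    module C = CartStr (CartCat.str C)
    module D = CartStr (CartCat.str D)
    module CC = Category (CartCat.cat C)
    open Category (CartCat.cat D)
    coh : ∀ Γ →
      proj₁ (D.prod D.fst D.snd) ∘
        (proj₁ (D.prod (proj₁ (D.𝟙-term (F₀ F (C.𝟙 C.⊗ Γ)))) (F₁ F C.snd)) ∘
           F₁ F (proj₁ (C.prod (proj₁ (C.𝟙-term Γ)) CC.id)))
      ≡ proj₁ (D.prod (proj₁ (D.𝟙-term (F₀ F Γ))) id)
    coh Γ = proj₂ (proj₂ (proj₂ (D.prod (proj₁ (D.𝟙-term (F₀ F Γ))) id))) _
              (proj₂ (D.𝟙-term (F₀ F Γ)) _) e2
      where
        A = proj₁ (D.prod {D.𝟙} {F₀ F Γ} D.fst D.snd)
        B = proj₁ (D.prod (proj₁ (D.𝟙-term (F₀ F (C.𝟙 C.⊗ Γ)))) (F₁ F C.snd))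
        pr = C.prod (proj₁ (C.𝟙-term Γ)) CC.id
        Cm = F₁ F (proj₁ pr)
        e2 : D.snd ∘ (A ∘ (B ∘ Cm)) ≡ id
        e2 = trans (sym (assoc D.snd A (B ∘ Cm)))
             (trans (cong (_∘ (B ∘ Cm)) (proj₁ (proj₂ (proj₂ (D.prod D.fst D.snd)))))
             (trans (sym (assoc D.snd B Cm))
             (trans (cong (_∘ Cm) (proj₁ (proj₂ (proj₂ (D.prod _ (F₁ F C.snd))))))
             (trans (sym (F-∘ F C.snd (proj₁ pr)))
             (trans (cong (F₁ F) (proj₁ (proj₂ (proj₂ pr))))
                    (F-id F))))))

-- C² is parameterised by
--   cs : a cartesian structure on the base category of each democratic scwf
--        (CCp² objects carry their cartesian structure as data)
--   cf : the fact that underlying functors of 1-cells are cartesian.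
-- On 2-cells both C² and L² are the identity (2-cells are natural
-- transformations between underlying functors in both 2-categories).
--
-- A biequivalence is given by pseudonatural equivalences
--   θ : Id ⇒ L² ∘ C²   on Scwf²_dem   and   ζ : Id ⇒ C² ∘ L²   on CCp².
-- A pseudonatural transformation θ : Id ⇒ T has 1-cell components θ X and,
-- for each 1-cell f, an invertible 2-cell  θ f : T f ∘ θ X ≅ θ Y ∘ f,
-- natural in 2-cells and compatible with identities and composition; it is
-- an equivalence when each component θ X is an equivalence in the
-- 2-category.  The unit and composition axioms are stated for every 1-cell k
-- equipped with an invertible 2-cell k ≅ id (resp. k ≅ g ∘ f).

module Forgetful
  (cs : (X : DemScwf) → CartStr (DemScwf.cat X))
  (cf : ∀ {X Y} (f : DemMor X Y) → IsCartFunctor (und f))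
  where

  C₀ : DemScwf → CartCat
  C₀ X = record { cat = DemScwf.cat X ; str = cs X }

  C₁ : ∀ {X Y} → DemMor X Y → CartFun (C₀ X) (C₀ Y)
  C₁ f = record { fun = und f ; cart = cf f }

  record PseudoNatEquivScwf : Set₁ where
    field
      θ  : (X : DemScwf) → DemMor X (L₀ (C₀ X))
      θ₁ : ∀ {X Y} (f : DemMor X Y) →
           NatIso (und (L₁ (C₁ f)) ∘F und (θ X)) (und (θ Y) ∘F und f)

    cmp : ∀ {X Y} (f : DemMor X Y) (x : Category.Obj (DemScwf.cat X)) →
          Category.Hom (DemScwf.cat Y)
            (F₀ (und (L₁ (C₁ f))) (F₀ (und (θ X)) x)) (F₀ (und (θ Y)) (F₀ (und f) x))
    cmp f x = NatTrans.η (NatIso.fwd (θ₁ f)) x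

    field
      θ-nat : ∀ {X Y} {f g : DemMor X Y} (α : NatTrans (und f) (und g)) x →
        Category._∘_ (DemScwf.cat Y) (cmp g x) (NatTrans.η α (F₀ (und (θ X)) x))
        ≡ Category._∘_ (DemScwf.cat Y) (F₁ (und (θ Y)) (NatTrans.η α x)) (cmp f x)
      θ-unit : ∀ {X} (k : DemMor X X) (φ : NatIso (und k) (IdF (DemScwf.cat X))) x →
        cmp k x
        ≡ Category._∘_ (DemScwf.cat X)
            (F₁ (und (θ X)) (NatTrans.η (NatIso.bwd φ) x))
            (NatTrans.η (NatIso.fwd φ) (F₀ (und (θ X)) x))
      θ-comp : ∀ {X Y Z} (f : DemMor X Y) (g : DemMor Y Z) (k : DemMor X Z)
                 (φ : NatIso (und k) (und g ∘F und f)) x →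
        cmp k x
        ≡ Category._∘_ (DemScwf.cat Z)
            (F₁ (und (θ Z)) (NatTrans.η (NatIso.bwd φ) x))
            (Category._∘_ (DemScwf.cat Z) (cmp g (F₀ (und f) x))
              (Category._∘_ (DemScwf.cat Z) (F₁ (und g) (cmp f x))
                 (NatTrans.η (NatIso.fwd φ) (F₀ (und (θ X)) x))))
      θ-equiv : ∀ X → Σ[ ε ∈ DemMor (L₀ (C₀ X)) X ]
        (NatIso (und ε ∘F und (θ X)) (IdF (DemScwf.cat X)) ×
         NatIso (und (θ X) ∘F und ε) (IdF (DemScwf.cat X)))

  record PseudoNatEquivCCp : Set₁ where
    field
      θ  : (C : CartCat) → CartFun C (C₀ (L₀ C))
      θ₁ : ∀ {C D} (f : CartFun C D) →
           NatIso (CartFun.fun (C₁ (L₁ f)) ∘F CartFun.fun (θ C))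
                  (CartFun.fun (θ D) ∘F CartFun.fun f)

    cmp : ∀ {C D} (f : CartFun C D) (x : Category.Obj (CartCat.cat C)) →
          Category.Hom (CartCat.cat D)
            (F₀ (CartFun.fun (C₁ (L₁ f))) (F₀ (CartFun.fun (θ C)) x))
            (F₀ (CartFun.fun (θ D)) (F₀ (CartFun.fun f) x))
    cmp f x = NatTrans.η (NatIso.fwd (θ₁ f)) x

    field
      θ-nat : ∀ {C D} {f g : CartFun C D}
                (α : NatTrans (CartFun.fun f) (CartFun.fun g)) x →
        Category._∘_ (CartCat.cat D) (cmp g x)
          (NatTrans.η α (F₀ (CartFun.fun (θ C)) x))
        ≡ Category._∘_ (CartCat.cat D)
            (F₁ (CartFun.fun (θ D)) (NatTrans.η α x)) (cmp f x)
      θ-unit : ∀ {C} (k : CartFun C C)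
                 (φ : NatIso (CartFun.fun k) (IdF (CartCat.cat C))) x →
        cmp k x
        ≡ Category._∘_ (CartCat.cat C)
            (F₁ (CartFun.fun (θ C)) (NatTrans.η (NatIso.bwd φ) x))
            (NatTrans.η (NatIso.fwd φ) (F₀ (CartFun.fun (θ C)) x))
      θ-comp : ∀ {C D E} (f : CartFun C D) (g : CartFun D E) (k : CartFun C E)
                 (φ : NatIso (CartFun.fun k) (CartFun.fun g ∘F CartFun.fun f)) x →
        cmp k x
        ≡ Category._∘_ (CartCat.cat E)
            (F₁ (CartFun.fun (θ E)) (NatTrans.η (NatIso.bwd φ) x))
            (Category._∘_ (CartCat.cat E) (cmp g (F₀ (CartFun.fun f) x))
              (Category._∘_ (CartCat.cat E) (F₁ (CartFun.fun g) (cmp f x))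
                 (NatTrans.η (NatIso.fwd φ) (F₀ (CartFun.fun (θ C)) x))))
      θ-equiv : ∀ C → Σ[ ε ∈ CartFun (C₀ (L₀ C)) C ]
        (NatIso (CartFun.fun ε ∘F CartFun.fun (θ C)) (IdF (CartCat.cat C)) ×
         NatIso (CartFun.fun (θ C) ∘F CartFun.fun ε) (IdF (CartCat.cat C)))

  IsBiequivalence : Set₁
  IsBiequivalence = PseudoNatEquivScwf × PseudoNatEquivCCp

-- A comprehension Γ · A is a product of Γ and 𝟏 · A, because terms of type A in context Δ
-- correspond to maps Δ → 𝟏 · A.  Democracy identifies 𝟏 · ‾Δ with Δ, so Γ · ‾Δ is a product
-- of Γ and Δ; pseudo scwf-morphisms preserve comprehensions, hence these products.
-- Conversely a product of Γ and B ≅ 𝟏 · A is a comprehension of Γ and A.  So the identity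
-- functor underlies democratic morphisms X → L(C X) and L(C X) → X, the composites of C and L
-- are the identity on base categories, and all pseudonaturality data consists of identities.
module Submission where

open import Defs
open import Data.Product using (_×_; _,_; proj₁; proj₂; Σ)
open import Relation.Binary.PropositionalEquality
  using (_≡_; refl; sym; trans; cong; module ≡-Reasoning)

module CategoryProperties (C : Category) where
  open Category C
  open ≡-Reasoning

  Iso-sym : ∀ {A B} → Iso C A B → Iso C B A
  Iso-sym i = record
    { to = Iso.from i ; from = Iso.to i ; isoˡ = Iso.isoʳ i ; isoʳ = Iso.isoˡ i }

  from∘to∘-cancel : ∀ {A B X} (i : Iso C A B) (g : Hom X A) →
                    Iso.from i ∘ (Iso.to i ∘ g) ≡ g
  from∘to∘-cancel i g = begin
    Iso.from i ∘ (Iso.to i ∘ g)  ≡⟨ sym (assoc _ _ _) ⟩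
    (Iso.from i ∘ Iso.to i) ∘ g  ≡⟨ cong (_∘ g) (Iso.isoˡ i) ⟩
    id ∘ g                       ≡⟨ identityˡ g ⟩
    g                            ∎

  to∘from∘-cancel : ∀ {A B X} (i : Iso C A B) (g : Hom X B) →
                    Iso.to i ∘ (Iso.from i ∘ g) ≡ g
  to∘from∘-cancel i = from∘to∘-cancel (Iso-sym i)

  !-unique₂ : ∀ {T} → IsTerminal C T → ∀ {X} (f g : Hom X T) → f ≡ g
  !-unique₂ t {X} f g = trans (proj₂ (t X) f) (sym (proj₂ (t X) g))

  terminal-Iso : ∀ {T T'} → IsTerminal C T → IsTerminal C T' → Iso C T T'
  terminal-Iso t t' = record
    { to = proj₁ (t' _) ; from = proj₁ (t _)
    ; isoˡ = !-unique₂ t _ _ ; isoʳ = !-unique₂ t' _ _ }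

  IsTerminal-resp-Iso : ∀ {T T'} → Iso C T T' → IsTerminal C T → IsTerminal C T'
  IsTerminal-resp-Iso i t X = Iso.to i ∘ proj₁ (t X) , λ g → begin
    g                              ≡⟨ sym (to∘from∘-cancel i g) ⟩
    Iso.to i ∘ (Iso.from i ∘ g)    ≡⟨ cong (Iso.to i ∘_) (proj₂ (t X) _) ⟩
    Iso.to i ∘ proj₁ (t X)         ∎

  id-comm : ∀ {A B} (f : Hom A B) → id ∘ f ≡ f ∘ id
  id-comm f = trans (identityˡ f) (sym (identityʳ f))

  IsProduct-resp-≡ : ∀ {A B P} {π₁ π₁' : Hom P A} {π₂ π₂' : Hom P B} →
                     π₁ ≡ π₁' → π₂ ≡ π₂' → IsProduct C π₁ π₂ → IsProduct C π₁' π₂'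
  IsProduct-resp-≡ refl refl pr = pr

  IsProduct-∘-Iso : ∀ {A B P Q} {π₁ : Hom Q A} {π₂ : Hom Q B} (i : Iso C P Q) →
                    IsProduct C π₁ π₂ → IsProduct C (π₁ ∘ Iso.to i) (π₂ ∘ Iso.to i)
  IsProduct-∘-Iso {π₁ = π₁} {π₂} i pr f g =
    Iso.from i ∘ h , β π₁ (proj₁ (proj₂ (pr f g))) , β π₂ (proj₁ (proj₂ (proj₂ (pr f g)))) ,
    λ h' e₁ e₂ → begin
      h'                            ≡⟨ sym (from∘to∘-cancel i h') ⟩
      Iso.from i ∘ (Iso.to i ∘ h')  ≡⟨ cong (Iso.from i ∘_)
                                         (proj₂ (proj₂ (proj₂ (pr f g))) _
                                           (trans (sym (assoc _ _ _)) e₁)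
                                           (trans (sym (assoc _ _ _)) e₂)) ⟩
      Iso.from i ∘ h                ∎
    where
      h = proj₁ (pr f g)
      β : ∀ {Y} {k : Hom _ Y} (π : Hom _ Y) → π ∘ h ≡ k → (π ∘ Iso.to i) ∘ (Iso.from i ∘ h) ≡ k
      β π e = trans (assoc _ _ _) (trans (cong (π ∘_) (to∘from∘-cancel i h)) e)

  IsProduct-Iso-∘ : ∀ {A B B' P} {π₁ : Hom P A} {π₂ : Hom P B} (i : Iso C B B') →
                    IsProduct C π₁ π₂ → IsProduct C π₁ (Iso.to i ∘ π₂)
  IsProduct-Iso-∘ {π₂ = π₂} i pr f g =
    h , proj₁ (proj₂ (pr f g')) ,
    trans (assoc _ _ _) (trans (cong (Iso.to i ∘_) (proj₁ (proj₂ (proj₂ (pr f g')))))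
                               (to∘from∘-cancel i g)) ,
    λ h' e₁ e₂ → proj₂ (proj₂ (proj₂ (pr f g'))) h' e₁ (begin
      π₂ ∘ h'                          ≡⟨ sym (from∘to∘-cancel i _) ⟩
      Iso.from i ∘ (Iso.to i ∘ π₂ ∘ h') ≡⟨ cong (Iso.from i ∘_) (trans (sym (assoc _ _ _)) e₂) ⟩
      g'                               ∎)
    where
      g' = Iso.from i ∘ g
      h = proj₁ (pr f g')

  IsProduct-ext : ∀ {A B P X} {π₁ : Hom P A} {π₂ : Hom P B} → IsProduct C π₁ π₂ →
                  {h h' : Hom X P} → π₁ ∘ h ≡ π₁ ∘ h' → π₂ ∘ h ≡ π₂ ∘ h' → h ≡ h'
  IsProduct-ext pr {h} {h'} e₁ e₂ =
    trans (u h e₁ e₂) (sym (u h' refl refl))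
    where u = proj₂ (proj₂ (proj₂ (pr _ _)))

  IsProduct-unique : ∀ {A B P Q} {π₁ : Hom P A} {π₂ : Hom P B} {ρ₁ : Hom Q A} {ρ₂ : Hom Q B} →
                     IsProduct C π₁ π₂ → IsProduct C ρ₁ ρ₂ →
                     Σ (Iso C P Q) λ i → (ρ₁ ∘ Iso.to i ≡ π₁) × (ρ₂ ∘ Iso.to i ≡ π₂)
  IsProduct-unique {π₁ = π₁} {π₂} {ρ₁} {ρ₂} prP prQ =
    record { to = to ; from = from
           ; isoˡ = IsProduct-ext prP (back-and-forth from₁ to₁) (back-and-forth from₂ to₂)
           ; isoʳ = IsProduct-ext prQ (back-and-forth to₁ from₁) (back-and-forth to₂ from₂) } ,
    to₁ , to₂
    where
      to = proj₁ (prQ π₁ π₂)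
      to₁ = proj₁ (proj₂ (prQ π₁ π₂))
      to₂ = proj₁ (proj₂ (proj₂ (prQ π₁ π₂)))
      from = proj₁ (prP ρ₁ ρ₂)
      from₁ = proj₁ (proj₂ (prP ρ₁ ρ₂))
      from₂ = proj₁ (proj₂ (proj₂ (prP ρ₁ ρ₂)))
      back-and-forth : ∀ {R S Y} {σ : Hom R Y} {τ : Hom S Y} {f : Hom S R} {g : Hom R S} →
                       σ ∘ f ≡ τ → τ ∘ g ≡ σ → σ ∘ (f ∘ g) ≡ σ ∘ id
      back-and-forth {σ = σ} {g = g} e e' =
        trans (sym (assoc _ _ _)) (trans (cong (_∘ g) e) (trans e' (sym (identityʳ σ))))

F-Iso : {C D : Category} (F : Functor C D) {A B : Category.Obj C} →
        Iso C A B → Iso D (F₀ F A) (F₀ F B)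
F-Iso F i = record
  { to = F₁ F (Iso.to i) ; from = F₁ F (Iso.from i)
  ; isoˡ = trans (sym (F-∘ F _ _)) (trans (cong (F₁ F) (Iso.isoˡ i)) (F-id F))
  ; isoʳ = trans (sym (F-∘ F _ _)) (trans (cong (F₁ F) (Iso.isoʳ i)) (F-id F)) }

IsCartFunctor-fromChosen : {C D : Category} (F : Functor C D) (S : CartStr C) →
                           IsTerminal D (F₀ F (CartStr.𝟙 S)) →
                           (∀ {A B} → IsProduct D (F₁ F (CartStr.fst S {A} {B}))
                                                  (F₁ F (CartStr.snd S {A} {B}))) →
                           IsCartFunctor F
IsCartFunctor-fromChosen {C} {D} F S F𝟙 Fprod =
  (λ T t → D.IsTerminal-resp-Iso (F-Iso F (C.terminal-Iso 𝟙-term t)) F𝟙) ,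
  λ π₁ π₂ pr →
    let (i , e₁ , e₂) = C.IsProduct-unique pr prod in
    D.IsProduct-resp-≡ (F-∘-≡ e₁) (F-∘-≡ e₂) (D.IsProduct-∘-Iso (F-Iso F i) Fprod)
  where
    open CartStr S
    module C = CategoryProperties C
    module D = CategoryProperties D
    F-∘-≡ : ∀ {A B E} {g : Category.Hom C B E} {f : Category.Hom C A B} {h} →
            Category._∘_ C g f ≡ h → Category._∘_ D (F₁ F g) (F₁ F f) ≡ F₁ F h
    F-∘-≡ {g = g} {f} e = trans (sym (F-∘ F g f)) (cong (F₁ F) e)

module ComprehensionProperties (S : PreScwf) where
  open PreScwf S
  open Category cat
  open ≡-Reasoning

  compr-ext : ∀ {T A E X} {pE : Hom E T} {qE : Tm E A} →
              IsTerminal cat T → IsCompr S T A E pE qE →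
              {m n : Hom X E} → qE [ m ] ≡ qE [ n ] → m ≡ n
  compr-ext {X = X} {qE = qE} t c {m} {n} e =
    trans (u m (proj₂ (t X) _) e) (sym (u n (proj₂ (t X) _) refl))
    where u = proj₂ (proj₂ (proj₂ (c (proj₁ (t X)) (qE [ n ]))))

  compr-isProduct : ∀ {Γ A E T E'} {pE : Hom E Γ} {qE : Tm E A} {pE' : Hom E' T} {qE' : Tm E' A} →
                    IsCompr S Γ A E pE qE → IsTerminal cat T → IsCompr S T A E' pE' qE' →
                    (k : Hom E E') → qE' [ k ] ≡ qE → IsProduct cat pE k
  compr-isProduct {qE = qE} {qE' = qE'} c t c' k kq f g =
    h , proj₁ (proj₂ (c f a)) , kh ,
    λ h' e₁ e₂ → proj₂ (proj₂ (proj₂ (c f a))) h' e₁ (begin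
      qE [ h' ]          ≡⟨ cong (_[ h' ]) (sym kq) ⟩
      (qE' [ k ]) [ h' ] ≡⟨ sym ([∘] qE' k h') ⟩
      qE' [ k ∘ h' ]     ≡⟨ cong (qE' [_]) e₂ ⟩
      a                  ∎)
    where
      a = qE' [ g ]
      h = proj₁ (c f a)
      kh : k ∘ h ≡ g
      kh = compr-ext t c' (begin
        qE' [ k ∘ h ]      ≡⟨ [∘] qE' k h ⟩
        (qE' [ k ]) [ h ]  ≡⟨ cong (_[ h ]) kq ⟩
        qE [ h ]           ≡⟨ proj₁ (proj₂ (proj₂ (c f a))) ⟩
        a                  ∎)

  product-isCompr : ∀ {Γ A P T E'} {π₁ : Hom P Γ} {π₂ : Hom P E'} {pE' : Hom E' T} {qE' : Tm E' A} →
                    IsProduct cat π₁ π₂ → IsTerminal cat T → IsCompr S T A E' pE' qE' →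
                    IsCompr S Γ A P π₁ (qE' [ π₂ ])
  product-isCompr {π₂ = π₂} {qE' = qE'} pr t c' γ a =
    h , proj₁ (proj₂ (pr γ k)) , qh ,
    λ h' e₁ e₂ → proj₂ (proj₂ (proj₂ (pr γ k))) h' e₁
                   (compr-ext t c' (trans ([∘] qE' π₂ h') (trans e₂ (sym kq))))
    where
      k = proj₁ (c' (proj₁ (t _)) a)
      kq = proj₁ (proj₂ (proj₂ (c' (proj₁ (t _)) a)))
      h = proj₁ (pr γ k)
      qh : (qE' [ π₂ ]) [ h ] ≡ a
      qh = begin
        (qE' [ π₂ ]) [ h ] ≡⟨ sym ([∘] qE' π₂ h) ⟩
        qE' [ π₂ ∘ h ]     ≡⟨ cong (qE' [_]) (proj₁ (proj₂ (proj₂ (pr γ k)))) ⟩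
        qE' [ k ]          ≡⟨ kq ⟩
        a                  ∎

module ScwfProperties (S : Scwf) where
  open Scwf S
  open Category cat
  open ComprehensionProperties pre

  q[⟨⟩] : ∀ {Δ Γ A} (γ : Hom Δ Γ) (a : Tm Δ A) → q [ ⟨ γ , a ⟩ ] ≡ a
  q[⟨⟩] γ a = proj₁ (proj₂ (proj₂ (compr γ a)))

  ⟨p,q⟩≡id : ∀ {Γ A} → ⟨ p {Γ} {A} , q ⟩ ≡ id
  ⟨p,q⟩≡id = sym (proj₂ (proj₂ (proj₂ (compr p q))) id (identityʳ p) ([id] q))

  ⟨!,q[]⟩-η : ∀ {Δ A} (h : Hom Δ (𝟏 · A)) → ⟨ ! Δ , q [ h ] ⟩ ≡ h
  ⟨!,q[]⟩-η h = compr-ext 𝟏-term compr (q[⟨⟩] _ _)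

  ⟨!,⟩-∘ : ∀ {Δ Γ A} (a : Tm Γ A) (γ : Hom Δ Γ) → ⟨ ! Γ , a ⟩ ∘ γ ≡ ⟨ ! Δ , a [ γ ] ⟩
  ⟨!,⟩-∘ a γ = compr-ext 𝟏-term compr
    (trans ([∘] q _ γ) (trans (cong (_[ γ ]) (q[⟨⟩] _ a)) (sym (q[⟨⟩] _ _))))

  TyIso-refl : ∀ {Γ A} → TyIso S Γ A A
  TyIso-refl = record { to = q ; from = q ; isoˡ = q[⟨⟩] p q ; isoʳ = q[⟨⟩] p q }

demCartStr : (X : DemScwf) → CartStr (DemScwf.cat X)
demCartStr X = record
  { 𝟙 = 𝟏 ; 𝟙-term = 𝟏-term ; _⊗_ = λ Γ Δ → Γ · ov Δ ; fst = p
  ; snd = λ {_} {Δ} → Iso.from (γd Δ) ∘ ⟨ ! _ , q ⟩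
  ; prod = λ {_} {Δ} → IsProduct-Iso-∘ (Iso-sym (γd Δ))
                         (compr-isProduct compr 𝟏-term compr _ (q[⟨⟩] _ _)) }
  where
    open DemScwf X
    open Category cat
    open CategoryProperties cat
    open ComprehensionProperties pre
    open ScwfProperties scwf

demMor-isCart : ∀ {X Y} (f : DemMor X Y) → IsCartFunctor (und f)
demMor-isCart {X} {Y} f = IsCartFunctor-fromChosen F (demCartStr X) F𝟏 λ {_} {Δ} →
  CY.IsProduct-resp-≡ refl (sym (F-∘ F _ _))
    (CY.IsProduct-Iso-∘ (F-Iso F (CX.Iso-sym (X.γd Δ)))
      (compr-isProduct (Fcompr _ _) F𝟏 (Fcompr _ _) _
        (trans (sym (FTm-nat X.q _)) (cong FTm (q[⟨⟩] _ _)))))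
  where
    module X = DemScwf X
    module Y = DemScwf Y
    module CX = CategoryProperties X.cat
    module CY = CategoryProperties Y.cat
    open DemMor f
    open ComprehensionProperties Y.pre
    open ScwfProperties X.scwf

module CartesianProperties {C : Category} (S : CartStr C) where
  open Category C
  open CartStr S

  pair : ∀ {X A B} → Hom X A → Hom X B → Hom X (A ⊗ B)
  pair f g = proj₁ (prod f g)

  snd∘pair : ∀ {X A B} (f : Hom X A) (g : Hom X B) → snd ∘ pair f g ≡ g
  snd∘pair f g = proj₁ (proj₂ (proj₂ (prod f g)))

  snd∘pair∘ : ∀ {Y X A B} (f : Hom X A) (g : Hom X B) (h : Hom Y X) →
              snd ∘ (pair f g ∘ h) ≡ g ∘ h
  snd∘pair∘ f g h = trans (sym (assoc _ _ _)) (cong (_∘ h) (snd∘pair f g))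

  pair-𝟙-unique : ∀ {X B} {h : Hom X (𝟙 ⊗ B)} {g : Hom X B} →
                  snd ∘ h ≡ g → h ≡ pair (proj₁ (𝟙-term X)) g
  pair-𝟙-unique {X} {h = h} e = proj₂ (proj₂ (proj₂ (prod _ _))) h (proj₂ (𝟙-term X) _) e

L-TyIso : (C : CartCat) → ∀ {Γ A B} → Iso (CartCat.cat C) A B → TyIso (Lscwf C) Γ A B
L-TyIso C i = record
  { to = Iso.to i ∘ snd ; from = Iso.from i ∘ snd
  ; isoˡ = trans (assoc _ _ _) (trans (cong (Iso.from i ∘_) (snd∘pair _ _))
                                      (from∘to∘-cancel i snd))
  ; isoʳ = trans (assoc _ _ _) (trans (cong (Iso.to i ∘_) (snd∘pair _ _))
                                      (to∘from∘-cancel i snd)) }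
  where
    open CartCat C
    open Category cat
    open CartStr str
    open CategoryProperties cat
    open CartesianProperties str

module _ (X : DemScwf) (S : CartStr (DemScwf.cat X)) where
  open DemScwf X
  open Category cat
  open CategoryProperties cat
  open ComprehensionProperties pre
  open ScwfProperties scwf
  open CartStr S
  open CartesianProperties S
  open ≡-Reasoning

  private
    L : DemScwf
    L = L₀ (record { cat = cat ; str = S })

  DemScwf⇒L : DemMor X L
  DemScwf⇒L = record
    { F = IdF cat
    ; FTy = 𝟏 ·_
    ; FTm = λ {Γ} a → ⟨ ! Γ , a ⟩
    ; FTm-nat = λ a γ → sym (⟨!,⟩-∘ a γ)
    ; F𝟏 = 𝟏-term
    ; Fcompr = λ Γ A → compr-isProduct compr 𝟏-term compr _ (q[⟨⟩] _ q)
    ; d = λ Γ → L-TyIso _ (Iso-sym (γd Γ))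
    ; coh = λ Γ → pair-𝟙-unique (coh Γ)
    }
    where
      coh : ∀ Γ → let open Iso (γd Γ) in
            snd ∘ (pair fst (from ∘ snd) ∘ (pair (proj₁ (𝟙-term _)) ⟨ ! _ , q ⟩ ∘ to)) ≡ id
      coh Γ = begin
        snd ∘ (pair fst (from ∘ snd) ∘ (pair _ ⟨ ! _ , q ⟩ ∘ to))
          ≡⟨ snd∘pair∘ _ _ _ ⟩
        (from ∘ snd) ∘ (pair _ ⟨ ! _ , q ⟩ ∘ to)
          ≡⟨ assoc _ _ _ ⟩
        from ∘ (snd ∘ (pair _ ⟨ ! _ , q ⟩ ∘ to))
          ≡⟨ cong (from ∘_) (snd∘pair∘ _ _ _) ⟩
        from ∘ (⟨ ! _ , q ⟩ ∘ to)
          ≡⟨ cong (λ k → from ∘ (k ∘ to)) (trans (cong ⟨ ! _ ,_⟩ (sym ([id] q))) (⟨!,q[]⟩-η id)) ⟩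
        from ∘ (id ∘ to)
          ≡⟨ cong (from ∘_) (identityˡ to) ⟩
        from ∘ to
          ≡⟨ isoˡ ⟩
        id ∎
        where open Iso (γd Γ)

  L⇒DemScwf : DemMor L X
  L⇒DemScwf = record
    { F = IdF cat
    ; FTy = ov
    ; FTm = λ {_} {A} f → q [ Iso.to (γd A) ∘ f ]
    ; FTm-nat = λ a γ → trans (cong (q [_]) (sym (assoc _ _ _))) ([∘] q _ γ)
    ; F𝟏 = 𝟙-term
    ; Fcompr = λ Γ A → product-isCompr (IsProduct-Iso-∘ (γd A) prod) 𝟏-term compr
    ; d = λ Γ → TyIso-refl
    ; coh = coh
    }
    where
      coh : ∀ Γ → let open Iso (γd Γ) in
            ⟨ p , q ⟩ ∘ (⟨ ! _ , q [ to ∘ snd ] ⟩ ∘ pair (proj₁ (𝟙-term Γ)) id) ≡ to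
      coh Γ = begin
        ⟨ p , q ⟩ ∘ (k ∘ P)  ≡⟨ cong (_∘ (k ∘ P)) ⟨p,q⟩≡id ⟩
        id ∘ (k ∘ P)         ≡⟨ identityˡ (k ∘ P) ⟩
        k ∘ P                ≡⟨ cong (_∘ P) (⟨!,q[]⟩-η (to ∘ snd)) ⟩
        (to ∘ snd) ∘ P       ≡⟨ assoc to snd P ⟩
        to ∘ (snd ∘ P)       ≡⟨ cong (to ∘_) (snd∘pair _ id) ⟩
        to ∘ id              ≡⟨ identityʳ to ⟩
        to                   ∎
        where
          open Iso (γd Γ)
          k = ⟨ ! (𝟙 ⊗ Γ) , q [ to ∘ snd ] ⟩
          P = pair (proj₁ (𝟙-term Γ)) id

IdF-isCart : (C : Category) → IsCartFunctor (IdF C)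
IdF-isCart C = (λ T t → t) , (λ π₁ π₂ pr → pr)

module _ {C D : Category} where
  private
    module C = Category C
    module D = Category D
  open CategoryProperties D

  -- For functors that agree on objects and morphisms (their law proofs may differ).
  NatIso-id : {G₀ : C.Obj → D.Obj} {G₁ : ∀ {A B} → C.Hom A B → D.Hom (G₀ A) (G₀ B)}
              {i i' : ∀ {A} → G₁ (C.id {A}) ≡ D.id}
              {c c' : ∀ {A B E} (g : C.Hom B E) (f : C.Hom A B) → G₁ (g C.∘ f) ≡ G₁ g D.∘ G₁ f} →
              NatIso {C} {D} (record { F₀ = G₀ ; F₁ = G₁ ; F-id = i ; F-∘ = c })
                             (record { F₀ = G₀ ; F₁ = G₁ ; F-id = i' ; F-∘ = c' })
  NatIso-id {G₁ = G₁} = record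
    { fwd = record { η = λ _ → D.id ; natural = λ f → id-comm (G₁ f) }
    ; bwd = record { η = λ _ → D.id ; natural = λ f → id-comm (G₁ f) }
    ; isoˡ = λ _ → D.identityˡ D.id ; isoʳ = λ _ → D.identityˡ D.id }

module _ {B C D : Category} {F : Functor B C} {G : Functor C D} {K : Functor B D} where
  open Category D
  open NatTrans
  open NatIso

  NatIso-isoˡ-via-F-id : (φ : NatIso K (G ∘F F)) (x : Category.Obj B) →
                         η (bwd φ) x ∘ (id ∘ (F₁ G (Category.id C) ∘ η (fwd φ) x)) ≡ id
  NatIso-isoˡ-via-F-id φ x =
    trans (cong (η (bwd φ) x ∘_)
                (trans (identityˡ _) (trans (cong (_∘ _) (F-id G)) (identityˡ _))))
          (isoˡ φ x)

module Biequivalence (cs : (X : DemScwf) → CartStr (DemScwf.cat X))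
                     (cf : ∀ {X Y} (f : DemMor X Y) → IsCartFunctor (und f)) where
  open Forgetful cs cf

  unitScwf : PseudoNatEquivScwf
  unitScwf = record
    { θ = λ X → DemScwf⇒L X (cs X)
    ; θ₁ = λ {X} {Y} f → NatIso-id {DemScwf.cat X} {DemScwf.cat Y}
    ; θ-nat = λ {_} {Y} α x → CategoryProperties.id-comm (DemScwf.cat Y) _
    ; θ-unit = λ k φ x → sym (NatIso.isoˡ φ x)
    ; θ-comp = λ f g k φ x → sym (NatIso-isoˡ-via-F-id {F = und f} {G = und g} φ x)
    ; θ-equiv = λ X → let C = DemScwf.cat X in
        L⇒DemScwf X (cs X) , NatIso-id {C} {C} , NatIso-id {C} {C}
    }

  unitCCp : PseudoNatEquivCCp
  unitCCp = record
    { θ = λ C → record { fun = IdF (CartCat.cat C) ; cart = IdF-isCart (CartCat.cat C) }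
    ; θ₁ = λ {C} {D} f → NatIso-id {CartCat.cat C} {CartCat.cat D}
    ; θ-nat = λ {_} {D} α x → CategoryProperties.id-comm (CartCat.cat D) _
    ; θ-unit = λ k φ x → sym (NatIso.isoˡ φ x)
    ; θ-comp = λ f g k φ x →
        sym (NatIso-isoˡ-via-F-id {F = CartFun.fun f} {G = CartFun.fun g} φ x)
    ; θ-equiv = λ C → let C' = CartCat.cat C in
        record { fun = IdF C' ; cart = IdF-isCart C' } , NatIso-id {C'} {C'} , NatIso-id {C'} {C'}
    }

theorem3 : ((X : DemScwf) → CartStr (DemScwf.cat X))
           × (∀ {X Y} (f : DemMor X Y) → IsCartFunctor (und f))
           × ((cs : (X : DemScwf) → CartStr (DemScwf.cat X))
              (cf : ∀ {X Y} (f : DemMor X Y) → IsCartFunctor (und f)) →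
              Forgetful.IsBiequivalence cs cf)
theorem3 = demCartStr , demMor-isCart ,
           λ cs cf → Biequivalence.unitScwf cs cf , Biequivalence.unitCCp cs cf
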